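{- Let $T$ be a tree. Then (1) $T$ contains no critical $4$-path and no critical $K_{1,3}$; (2) every end-vertex of each insulated $\alpha_3$-critical edge of $T$ has exactly one neighbor in $\mathcal{A}_T$, and this neighbor is an isolated vertex of the induced subgraph $T[\mathcal{A}_T]$; (3) no vertex of a critical $3$-path of $T$ is adjacent to any vertex of $\mathcal{A}_T$.
   Context: A dissociation set of a graph $G$ is a set $S$ of vertices such that $G[S]$ has maximum degree at most $1$; a maximum dissociation set is one of maximum cardinality, which is denoted $\alpha_3(G)$. An edge $e$ is $\alpha_3$-critical if $\alpha_3(G-e)>\alpha_3(G)$, where $G-e$ is obtained by deleting $e$. A subgraph is critical if all its edges are $\alpha_3$-critical; a critical $k$-path is a subgraph isomorphic to the path on $k$ vertices all of whose edges are $\alpha_3$-critical, and a critical $K_{1,3}$ is a subgraph isomorphic to the star with three leaves all of whose edges are $\alpha_3$-critical. An $\alpha_3$-critical edge is insulated if it shares no end-vertex with any other $\alpha_3$-critical edge. $\mathcal{A}_T$ denotes the set of vertices of $T$ that belong to every maximum dissociation set of $T$. -}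

module Defs where

open import Data.Nat using (ℕ; _≤_; _<_; suc)
open import Data.Fin using (Fin)
open import Data.Fin.Subset using (Subset; _∈_; _∉_; ∣_∣)
open import Data.Bool using (Bool; T; _∧_; not)
open import Data.Fin.Properties using (_≟_)
open import Data.List using (List; []; _∷_; length; _∷ʳ_)
open import Data.List.Relation.Unary.Linked using (Linked)
open import Data.List.Relation.Unary.Unique.Propositional using (Unique)
open import Data.Product using (Σ; ∃; _×_; _,_)
open import Data.Sum using (_⊎_)
open import Relation.Binary.PropositionalEquality using (_≡_)
open import Relation.Nullary using (¬_)
open import Relation.Nullary.Decidable using (⌊_⌋)

-- A (finite, simple) graph on the vertex set Fin n, given by a Boolean
-- adjacency matrix.  Simplicity (symmetry, irreflexivity) is imposed by
-- the predicate IsTree below.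
Graph : ℕ → Set
Graph n = Fin n → Fin n → Bool

module _ {n : ℕ} (G : Graph n) where

  Adj : Fin n → Fin n → Set
  Adj u v = T (G u v)

  data Walk : Fin n → Fin n → Set where
    here : ∀ {u} → Walk u u
    step : ∀ {u w v} → Adj u w → Walk w v → Walk u v

  Connected : Set
  Connected = ∀ u v → Walk u v

  IsCycle : Fin n → List (Fin n) → Set
  IsCycle x ys = (2 ≤ length ys) × Unique (x ∷ ys) × Linked Adj ((x ∷ ys) ∷ʳ x)

  Acyclic : Set
  Acyclic = ∀ x ys → ¬ IsCycle x ys

  IsTree : Set
  IsTree = (0 < n) × (∀ u v → Adj u v → Adj v u) × (∀ u → ¬ Adj u u)
           × Connected × Acyclic

  -- dissociation set: G[S] has maximum degree at most 1
  IsDissociation : Subset n → Set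
  IsDissociation S = ∀ v u w → v ∈ S → u ∈ S → w ∈ S →
                     Adj v u → Adj v w → u ≡ w

  IsMaxDissociation : Subset n → Set
  IsMaxDissociation S = IsDissociation S ×
                        (∀ S′ → IsDissociation S′ → ∣ S′ ∣ ≤ ∣ S ∣)

  IsAlpha3 : ℕ → Set
  IsAlpha3 k = Σ (Subset n) λ S → IsMaxDissociation S × ∣ S ∣ ≡ k

  InA : Fin n → Set
  InA v = ∀ S → IsMaxDissociation S → v ∈ S

deleteEdge : ∀ {n} → Graph n → Fin n → Fin n → Graph n
deleteEdge G a b u v =
  G u v ∧ not ((⌊ u ≟ a ⌋ ∧ ⌊ v ≟ b ⌋) Data.Bool.∨ (⌊ u ≟ b ⌋ ∧ ⌊ v ≟ a ⌋))
  where import Data.Bool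

Critical : ∀ {n} → Graph n → Fin n → Fin n → Set
Critical G u v = Adj G u v ×
  (∀ k k′ → IsAlpha3 G k → IsAlpha3 (deleteEdge G u v) k′ → k < k′)

Critical3Path : ∀ {n} → Graph n → Fin n → Fin n → Fin n → Set
Critical3Path G a b c = ¬ a ≡ b × ¬ a ≡ c × ¬ b ≡ c ×
                        Critical G a b × Critical G b c

Critical4Path : ∀ {n} → Graph n → Fin n → Fin n → Fin n → Fin n → Set
Critical4Path G a b c d = Unique (a ∷ b ∷ c ∷ d ∷ []) ×
                          Critical G a b × Critical G b c × Critical G c d

CriticalClaw : ∀ {n} → Graph n → Fin n → Fin n → Fin n → Fin n → Set
CriticalClaw G c x y z = Unique (c ∷ x ∷ y ∷ z ∷ []) ×
                         Critical G c x × Critical G c y × Critical G c z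

Insulated : ∀ {n} → Graph n → Fin n → Fin n → Set
Insulated G u v = Critical G u v ×
                  (∀ w → Critical G u w → w ≡ v) × (∀ w → Critical G w u → w ≡ v) ×
                  (∀ w → Critical G v w → w ≡ u) × (∀ w → Critical G w v → w ≡ u)

UniqueIsolatedANeighbour : ∀ {n} → Graph n → Fin n → Set
UniqueIsolatedANeighbour G x =
  ∃ λ y → (Adj G x y × InA G y) ×
          (∀ z → Adj G x z → InA G z → z ≡ y) ×
          (∀ z → InA G z → ¬ Adj G y z)

-- If ab is an α₃-critical edge, a maximum dissociation set X of T − ab is larger than α₃(T), so it
-- contains a and b, and X − a, X − b are maximum dissociation sets of T; in particular X contains 𝒜_T.
-- The side of b (the component of T − ab containing b) is joined to the rest of T by ab alone, so a
-- dissociation set of T − ab may be replaced on that side by any other one.  Hence every dissociation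
-- set of T − ab that is at least as large as X on the side of b contains b, and this propagates along
-- a critical path u v w: a set dominating the witness of vw on the side of v dominates the witness of
-- uv on the side of u, and contains u and v.  For three consecutive critical edges, or three critical
-- edges at one vertex, some witness then contains a vertex together with two of its neighbours.  For
-- an insulated edge uv the same exchanges show that X contains a neighbour y ≠ v of u lying in every
-- maximum dissociation set; uniqueness and isolation of y follow because 𝒜_T ⊆ X − u and X − v.
module Submission where

open import Defs
open import Data.Bool using (T; T?; _∧_; not; false)
open import Data.Bool.Properties using (∨-comm; ∧-zeroʳ; ∧-identityʳ; T-∧)
open import Data.Empty using (⊥)
open import Data.Fin using (Fin)
open import Data.Fin.Properties using (_≟_; all?; any?)
open import Data.Fin.Subset
  using (Subset; _∈_; _∉_; _⊆_; _∩_; _∪_; _─_; _-_; ⁅_⁆; ∣_∣; inside; outside)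
  renaming (⊥ to ∅)
open import Data.Fin.Subset.Properties
  using ( _∈?_; x∈⁅x⁆; ∣⁅x⁆∣≡1; ∣p∩q∣≤∣q∣; p─q⊆p; x∈p∩q⁻; x∈p∩q⁺; x∈p∪q⁻; x∈p∪q⁺
        ; x∈p∧x∉q⇒x∈p─q; x∈p∧x≢y⇒x∈p-y; p⊆q⇒∣p∣≤∣q∣; ∩-identityʳ; ⊆⊤; ∉⊥; anySubset?; ∣p∣≤n )
open import Data.List using (List; []; _∷_; length; _∷ʳ_)
open import Data.List.Membership.Propositional using () renaming (_∈_ to _∈ₗ_; _∉_ to _∉ₗ_)
open import Data.List.Relation.Binary.Subset.Propositional using () renaming (_⊆_ to _⊆ₗ_)
open import Data.List.Relation.Unary.All using ([]; _∷_)
open import Data.List.Relation.Unary.All.Properties using (¬Any⇒All¬)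
open import Data.List.Relation.Unary.AllPairs using ([]; _∷_)
open import Data.List.Relation.Unary.Any as Any using (here; there)
open import Data.List.Relation.Unary.Linked using (Linked; [-]; _∷_)
open import Data.List.Relation.Unary.Unique.Propositional using (Unique)
open import Data.Nat using (ℕ; zero; suc; _+_; _≤_; _<_; _≤?_; z≤n; s≤s)
open import Data.Nat.Properties
  using ( +-suc; +-mono-≤; +-mono-<-≤; +-monoˡ-≤; ≤-refl; ≤-trans; ≤-<-trans; <-≤-trans; <-irrefl
        ; ≰⇒>; <⇒≱; ≤⇒≯; m<1+n⇒m≤n; module ≤-Reasoning )
open import Data.Product using (Σ; ∃; _×_; _,_; proj₁; proj₂)
open import Data.Sum using (_⊎_; inj₁; inj₂; [_,_])
open import Data.Vec using ([]; _∷_; tabulate) renaming (here to hereᵛ; there to thereᵛ)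
open import Data.Vec.Properties using (lookup∘tabulate; []=⇒lookup; lookup⇒[]=)
open import Function using (_∘_; Equivalence)
open import Level using (Level)
open import Relation.Binary.PropositionalEquality
  using (_≡_; _≢_; refl; sym; trans; cong; subst; subst₂)
open import Relation.Nullary using (¬_; Dec; does; yes; no; contradiction)
open import Relation.Nullary.Decidable using (⌊_⌋; _×-dec_; _→-dec_; ¬?; dec-true; decidable-stable)
open import Relation.Unary using (Pred; Decidable)

private
  variable
    ℓ : Level
    n : ℕ
    a b c d p q q′ r s t u v w x y z : Fin n
    B C f g S S′ X Y X₁ X₂ X₃ : Subset n
    F F′ F₁ F₂ : Graph n

-- Vertex sets

x∈p─q⇒x∉q : ∀ (p q : Subset n) → x ∈ p ─ q → x ∉ q
x∈p─q⇒x∉q (s ∷ p) (inside ∷ q) () hereᵛ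
x∈p─q⇒x∉q (s ∷ p) (t ∷ q) (thereᵛ x∈p─q) (thereᵛ x∈q) = x∈p─q⇒x∉q p q x∈p─q x∈q

x∈p-y⇒x≢y : ∀ (p : Subset n) → x ∈ p - y → x ≢ y
x∈p-y⇒x≢y {y = y} p x∈p-y refl = x∈p─q⇒x∉q p ⁅ y ⁆ x∈p-y (x∈⁅x⁆ y)

p-x⊆p : ∀ (p : Subset n) x → p - x ⊆ p
p-x⊆p p x = p─q⊆p p ⁅ x ⁆

∩-monoˡ-⊆ : ∀ B → S ⊆ S′ → S ∩ B ⊆ S′ ∩ B
∩-monoˡ-⊆ {S = S} B S⊆S′ x∈ = let x∈S , x∈B = x∈p∩q⁻ S B x∈ in x∈p∩q⁺ (S⊆S′ x∈S , x∈B)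

p∩q-x⊆p-x∩q : ∀ (p q : Subset n) x → (p ∩ q) - x ⊆ (p - x) ∩ q
p∩q-x⊆p-x∩q p q x y∈ = let y∈p , y∈q = x∈p∩q⁻ p q (p-x⊆p (p ∩ q) x y∈) in
  x∈p∩q⁺ (x∈p∧x≢y⇒x∈p-y y∈p (x∈p-y⇒x≢y (p ∩ q) y∈) , y∈q)

x∉q⇒p∩q⊆p-x∩q : ∀ (p q : Subset n) → x ∉ q → p ∩ q ⊆ (p - x) ∩ q
x∉q⇒p∩q⊆p-x∩q p q x∉q y∈ = let y∈p , y∈q = x∈p∩q⁻ p q y∈ in
  x∈p∩q⁺ (x∈p∧x≢y⇒x∈p-y y∈p (λ { refl → x∉q y∈q }) , y∈q)

∣p∣≡∣p∩q∣+∣p─q∣ : ∀ (p q : Subset n) → ∣ p ∣ ≡ ∣ p ∩ q ∣ + ∣ p ─ q ∣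
∣p∣≡∣p∩q∣+∣p─q∣ []            []            = refl
∣p∣≡∣p∩q∣+∣p─q∣ (inside  ∷ p) (inside  ∷ q) = cong suc (∣p∣≡∣p∩q∣+∣p─q∣ p q)
∣p∣≡∣p∩q∣+∣p─q∣ (inside  ∷ p) (outside ∷ q) =
  trans (cong suc (∣p∣≡∣p∩q∣+∣p─q∣ p q)) (sym (+-suc ∣ p ∩ q ∣ ∣ p ─ q ∣))
∣p∣≡∣p∩q∣+∣p─q∣ (outside ∷ p) (inside  ∷ q) = ∣p∣≡∣p∩q∣+∣p─q∣ p q
∣p∣≡∣p∩q∣+∣p─q∣ (outside ∷ p) (outside ∷ q) = ∣p∣≡∣p∩q∣+∣p─q∣ p q

∣p∣≤1+∣p-x∣ : ∀ (p : Subset n) x → ∣ p ∣ ≤ suc ∣ p - x ∣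
∣p∣≤1+∣p-x∣ p x = subst (_≤ suc ∣ p - x ∣) (sym (∣p∣≡∣p∩q∣+∣p─q∣ p ⁅ x ⁆))
  (+-monoˡ-≤ ∣ p - x ∣ (subst (∣ p ∩ ⁅ x ⁆ ∣ ≤_) (∣⁅x⁆∣≡1 x) (∣p∩q∣≤∣q∣ p ⁅ x ⁆)))

∣∣-≤-by-parts : ∣ S ∩ B ∣ ≤ ∣ S′ ∩ B ∣ → S ─ B ⊆ S′ ─ B → ∣ S ∣ ≤ ∣ S′ ∣
∣∣-≤-by-parts {S = S} {B} {S′} inside≤ outside⊆ = begin
  ∣ S ∣                   ≡⟨ ∣p∣≡∣p∩q∣+∣p─q∣ S B ⟩
  ∣ S ∩ B ∣ + ∣ S ─ B ∣   ≤⟨ +-mono-≤ inside≤ (p⊆q⇒∣p∣≤∣q∣ outside⊆) ⟩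
  ∣ S′ ∩ B ∣ + ∣ S′ ─ B ∣ ≡⟨ ∣p∣≡∣p∩q∣+∣p─q∣ S′ B ⟨
  ∣ S′ ∣                  ∎
  where open ≤-Reasoning

∣∣-<-by-parts : ∣ S ∩ B ∣ < ∣ S′ ∩ B ∣ → S ─ B ⊆ S′ ─ B → ∣ S ∣ < ∣ S′ ∣
∣∣-<-by-parts {S = S} {B} {S′} inside< outside⊆ = begin-strict
  ∣ S ∣                   ≡⟨ ∣p∣≡∣p∩q∣+∣p─q∣ S B ⟩
  ∣ S ∩ B ∣ + ∣ S ─ B ∣   <⟨ +-mono-<-≤ inside< (p⊆q⇒∣p∣≤∣q∣ outside⊆) ⟩
  ∣ S′ ∩ B ∣ + ∣ S′ ─ B ∣ ≡⟨ ∣p∣≡∣p∩q∣+∣p─q∣ S′ B ⟨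
  ∣ S′ ∣                  ∎
  where open ≤-Reasoning

glue : Subset n → Subset n → Subset n → Subset n
glue B f g = (f ∩ B) ∪ (g ─ B)

glue-inside : x ∈ glue B f g → x ∈ B → x ∈ f
glue-inside {B = B} {f} {g} x∈ x∈B with x∈p∪q⁻ (f ∩ B) (g ─ B) x∈
... | inj₁ x∈f∩B = proj₁ (x∈p∩q⁻ f B x∈f∩B)
... | inj₂ x∈g─B = contradiction x∈B (x∈p─q⇒x∉q g B x∈g─B)

glue-outside : x ∈ glue B f g → x ∉ B → x ∈ g
glue-outside {B = B} {f} {g} x∈ x∉B with x∈p∪q⁻ (f ∩ B) (g ─ B) x∈
... | inj₁ x∈f∩B = contradiction (proj₂ (x∈p∩q⁻ f B x∈f∩B)) x∉B
... | inj₂ x∈g─B = p─q⊆p g B x∈g─B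

glue-inside⁺ : x ∈ B → x ∈ f → x ∈ glue B f g
glue-inside⁺ x∈B x∈f = x∈p∪q⁺ (inj₁ (x∈p∩q⁺ (x∈f , x∈B)))

glue-outside⁺ : x ∉ B → x ∈ g → x ∈ glue B f g
glue-outside⁺ x∉B x∈g = x∈p∪q⁺ (inj₂ (x∈p∧x∉q⇒x∈p─q x∈g x∉B))

module _ (B f g : Subset n) (B⊆C : B ⊆ C) where

  private
    inside⊆ : f ∩ B ⊆ (glue B f g ∩ C) ∩ B
    inside⊆ x∈ = let x∈f , x∈B = x∈p∩q⁻ f B x∈ in
      x∈p∩q⁺ (x∈p∩q⁺ (glue-inside⁺ x∈B x∈f , B⊆C x∈B) , x∈B)

    restrict⊆ : (g ∩ C) ∩ B ⊆ g ∩ B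
    restrict⊆ x∈ = let x∈g∩C , x∈B = x∈p∩q⁻ (g ∩ C) B x∈ in
      x∈p∩q⁺ (proj₁ (x∈p∩q⁻ g C x∈g∩C) , x∈B)

    outside⊆ : (g ∩ C) ─ B ⊆ (glue B f g ∩ C) ─ B
    outside⊆ x∈ = let x∈g , x∈C = x∈p∩q⁻ g C (p─q⊆p (g ∩ C) B x∈) ; x∉B = x∈p─q⇒x∉q (g ∩ C) B x∈ in
      x∈p∧x∉q⇒x∈p─q (x∈p∩q⁺ (glue-outside⁺ x∉B x∈g , x∈C)) x∉B

  ∣∣-≤-glue-within : ∣ g ∩ B ∣ ≤ ∣ f ∩ B ∣ → ∣ g ∩ C ∣ ≤ ∣ glue B f g ∩ C ∣
  ∣∣-≤-glue-within gain = ∣∣-≤-by-parts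
    (≤-trans (p⊆q⇒∣p∣≤∣q∣ restrict⊆) (≤-trans gain (p⊆q⇒∣p∣≤∣q∣ inside⊆))) outside⊆

  ∣∣-<-glue-within : ∣ g ∩ B ∣ < ∣ f ∩ B ∣ → ∣ g ∩ C ∣ < ∣ glue B f g ∩ C ∣
  ∣∣-<-glue-within gain = ∣∣-<-by-parts
    (≤-<-trans (p⊆q⇒∣p∣≤∣q∣ restrict⊆) (<-≤-trans gain (p⊆q⇒∣p∣≤∣q∣ inside⊆))) outside⊆

∣∣-≤-glue : ∀ (B f g : Subset n) → ∣ g ∩ B ∣ ≤ ∣ f ∩ B ∣ → ∣ g ∣ ≤ ∣ glue B f g ∣
∣∣-≤-glue B f g gain = subst₂ _≤_ (cong ∣_∣ (∩-identityʳ g)) (cong ∣_∣ (∩-identityʳ (glue B f g)))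
  (∣∣-≤-glue-within B f g ⊆⊤ gain)

∣∣-<-glue : ∀ (B f g : Subset n) → ∣ g ∩ B ∣ < ∣ f ∩ B ∣ → ∣ g ∣ < ∣ glue B f g ∣
∣∣-<-glue B f g gain = subst₂ _<_ (cong ∣_∣ (∩-identityʳ g)) (cong ∣_∣ (∩-identityʳ (glue B f g)))
  (∣∣-<-glue-within B f g ⊆⊤ gain)

subsetOf : {P : Pred (Fin n) ℓ} → Decidable P → Subset n
subsetOf P? = tabulate (does ∘ P?)

∈subsetOf⁺ : {P : Pred (Fin n) ℓ} (P? : Decidable P) → P x → x ∈ subsetOf P?
∈subsetOf⁺ {x = x} P? px = lookup⇒[]= x _ (trans (lookup∘tabulate (does ∘ P?) x) (dec-true (P? x) px))

∈subsetOf⁻ : {P : Pred (Fin n) ℓ} (P? : Decidable P) → x ∈ subsetOf P? → P x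
∈subsetOf⁻ {x = x} P? x∈ with P? x | trans (sym (lookup∘tabulate (does ∘ P?) x)) ([]=⇒lookup x∈)
... | yes px | _  = px
... | no  _  | ()

-- Edge deletion and dissociation sets

infix 4 _⊆ₑ_
_⊆ₑ_ : Graph n → Graph n → Set
F ⊆ₑ F′ = ∀ {u v} → Adj F u v → Adj F′ u v

deleteEdge-comm : ∀ (G : Graph n) a b u v → deleteEdge G a b u v ≡ deleteEdge G b a u v
deleteEdge-comm G a b u v = cong (λ e → G u v ∧ not e) (∨-comm (⌊ u ≟ a ⌋ ∧ ⌊ v ≟ b ⌋) _)

⌊≟⌋∧⌊≟⌋-false : ∀ (u a v b : Fin n) → ¬ (u ≡ a × v ≡ b) → ⌊ u ≟ a ⌋ ∧ ⌊ v ≟ b ⌋ ≡ false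
⌊≟⌋∧⌊≟⌋-false u a v b ≢ with u ≟ a | v ≟ b
... | yes u≡a | yes v≡b = contradiction (u≡a , v≡b) ≢
... | yes _   | no _    = refl
... | no _    | _       = refl

dissociation-⊆ : S′ ⊆ S → IsDissociation F S → IsDissociation F S′
dissociation-⊆ S′⊆S dis v u w v∈ u∈ w∈ = dis v u w (S′⊆S v∈) (S′⊆S u∈) (S′⊆S w∈)

dissociation-⊆ₑ : F′ ⊆ₑ F → IsDissociation F S → IsDissociation F′ S
dissociation-⊆ₑ F′⊆F dis v u w v∈ u∈ w∈ vu vw = dis v u w v∈ u∈ w∈ (F′⊆F vu) (F′⊆F vw)

module _ (G : Graph n) where

  deleteEdge⊆ₑ : deleteEdge G a b ⊆ₑ G
  deleteEdge⊆ₑ = proj₁ ∘ Equivalence.to T-∧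

  deleteEdge-removes : ¬ Adj (deleteEdge G a b) a b
  deleteEdge-removes {a} {b} adj with a ≟ a | b ≟ b
  ... | yes _   | yes _   = subst T (∧-zeroʳ (G a b)) adj
  ... | no a≢a  | _       = a≢a refl
  ... | _       | no b≢b  = b≢b refl

  deleteEdge-removes′ : ¬ Adj (deleteEdge G a b) b a
  deleteEdge-removes′ {a} {b} = deleteEdge-removes ∘ subst T (deleteEdge-comm G a b b a)

  deleteEdge-misses : Adj (deleteEdge G a b) u v → ¬ (u ≡ a × v ≡ b) × ¬ (u ≡ b × v ≡ a)
  deleteEdge-misses adj = (λ { (refl , refl) → deleteEdge-removes adj })
                        , (λ { (refl , refl) → deleteEdge-removes′ adj })

  deleteEdge-keeps : Adj G u v → ¬ (u ≡ a × v ≡ b) → ¬ (u ≡ b × v ≡ a) → Adj (deleteEdge G a b) u v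
  deleteEdge-keeps {u} {v} {a} {b} adj ≢ab ≢ba
    rewrite ⌊≟⌋∧⌊≟⌋-false u a v b ≢ab | ⌊≟⌋∧⌊≟⌋-false u b v a ≢ba | ∧-identityʳ (G u v) = adj

  deleteEdge-keeps-from : Adj G u v → u ≢ a → u ≢ b → Adj (deleteEdge G a b) u v
  deleteEdge-keeps-from adj u≢a u≢b = deleteEdge-keeps adj (u≢a ∘ proj₁) (u≢b ∘ proj₁)

  deleteEdge-keeps-avoiding : Adj G u v → u ≢ a → v ≢ a → Adj (deleteEdge G a b) u v
  deleteEdge-keeps-avoiding adj u≢a v≢a = deleteEdge-keeps adj (u≢a ∘ proj₁) (v≢a ∘ proj₂)

  deleteEdge-keeps-avoiding′ : Adj G u v → u ≢ b → v ≢ b → Adj (deleteEdge G a b) u v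
  deleteEdge-keeps-avoiding′ adj u≢b v≢b = deleteEdge-keeps adj (v≢b ∘ proj₂) (u≢b ∘ proj₁)

  dissociation-deleteEdge-comm : IsDissociation (deleteEdge G a b) S → IsDissociation (deleteEdge G b a) S
  dissociation-deleteEdge-comm {a} {b} = dissociation-⊆ₑ λ {u} {v} → subst T (deleteEdge-comm G b a u v)

  dissociation-deleteEdge⁻ : IsDissociation (deleteEdge G a b) S → a ∉ S → IsDissociation G S
  dissociation-deleteEdge⁻ {a} {S = S} dis a∉S v u w v∈ u∈ w∈ vu vw =
    dis v u w v∈ u∈ w∈ (deleteEdge-keeps-avoiding vu (≢a v∈) (≢a u∈))
                       (deleteEdge-keeps-avoiding vw (≢a v∈) (≢a w∈))
    where
    ≢a : x ∈ S → x ≢ a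
    ≢a x∈S refl = a∉S x∈S

  dissociation-minus : IsDissociation (deleteEdge G a b) X → IsDissociation G (X - a)
  dissociation-minus {a} {X = X} dis =
    dissociation-deleteEdge⁻ (dissociation-⊆ (p-x⊆p X a) dis) λ a∈X-a → x∈p-y⇒x≢y X a∈X-a refl

  dissociation-restoreEdge : IsDissociation (deleteEdge G a b) S →
    (∀ t → t ∈ S → Adj G a t → t ≡ b) → (∀ t → t ∈ S → Adj G b t → t ≡ a) → IsDissociation G S
  dissociation-restoreEdge {a} {b} dis only-b only-a v u w v∈ u∈ w∈ vu vw with v ≟ a | v ≟ b
  ... | yes refl | _        = trans (only-b u u∈ vu) (sym (only-b w w∈ vw))
  ... | no _     | yes refl = trans (only-a u u∈ vu) (sym (only-a w w∈ vw))
  ... | no v≢a   | no v≢b   =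
    dis v u w v∈ u∈ w∈ (deleteEdge-keeps-from vu v≢a v≢b) (deleteEdge-keeps-from vw v≢a v≢b)

deleteEdge-mono : F ⊆ₑ F′ → deleteEdge F a b ⊆ₑ deleteEdge F′ a b
deleteEdge-mono {F = F} {F′} F⊆F′ adj = let ≢ab , ≢ba = deleteEdge-misses F adj in
  deleteEdge-keeps F′ (F⊆F′ (deleteEdge⊆ₑ F adj)) ≢ab ≢ba

other-neighbour? : ∀ (F : Graph n) S w v →
  (∃ λ t → t ∈ S × Adj F w t × t ≢ v) ⊎ (∀ t → t ∈ S → Adj F w t → t ≡ v)
other-neighbour? F S w v with any? (λ t → t ∈? S ×-dec T? (F w t) ×-dec ¬? (t ≟ v))
... | yes found = inj₁ found
... | no  none  = inj₂ λ t t∈S wt → decidable-stable (t ≟ v) λ t≢v → none (t , t∈S , wt , t≢v)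

dissociation? : ∀ (F : Graph n) S → Dec (IsDissociation F S)
dissociation? F S = all? λ v → all? λ u → all? λ w →
  v ∈? S →-dec u ∈? S →-dec w ∈? S →-dec T? (F v u) →-dec T? (F v w) →-dec u ≟ w

maximumDissociation : ∀ (F : Graph n) → ∃ (IsMaxDissociation F)
maximumDissociation {n} F = search n (λ S _ → ∣p∣≤n S)
  where
  search : ∀ d → (∀ S → IsDissociation F S → ∣ S ∣ ≤ d) → ∃ (IsMaxDissociation F)
  search d bounded with anySubset? (λ S → dissociation? F S ×-dec d ≤? ∣ S ∣)
  ... | yes (S , disS , d≤∣S∣) = S , disS , λ S′ disS′ → ≤-trans (bounded S′ disS′) d≤∣S∣
  search zero    _ | no none = contradiction (∅ , (λ v u w v∈∅ → contradiction v∈∅ ∉⊥) , z≤n) none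
  search (suc d) _ | no none = search d λ S disS → m<1+n⇒m≤n (≰⇒> λ d<∣S∣ → none (S , disS , d<∣S∣))

-- Critical edges

module _ (G : Graph n) where

  CriticalWitness : Fin n → Fin n → Subset n → Set
  CriticalWitness a b X = IsDissociation (deleteEdge G a b) X × (∀ S → IsDissociation G S → ∣ S ∣ < ∣ X ∣)

  critical⇒witness : Critical G a b → ∃ (CriticalWitness a b)
  critical⇒witness {a} {b} (_ , α<α′) =
    let M , isMaxM = maximumDissociation G
        M′ , isMaxM′ = maximumDissociation (deleteEdge G a b)
    in M′ , proj₁ isMaxM′ , λ S disS →
         ≤-<-trans (proj₂ isMaxM S disS) (α<α′ _ _ (M , isMaxM , refl) (M′ , isMaxM′ , refl))

  witness⇒critical : Adj G a b → CriticalWitness a b X → Critical G a b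
  witness⇒critical {X = X} ab (disX , beats) =
    ab , λ { _ _ (S , (disS , _) , refl) (S′ , (_ , maxS′) , refl) →
               <-≤-trans (beats S disS) (maxS′ X disX) }

  witness-comm : CriticalWitness a b X → CriticalWitness b a X
  witness-comm (disX , beats) = dissociation-deleteEdge-comm G disX , beats

  witness-∋ : CriticalWitness a b X → a ∈ X
  witness-∋ {a} {X = X} (disX , beats) with a ∈? X
  ... | yes a∈X = a∈X
  ... | no  a∉X = contradiction (beats X (dissociation-deleteEdge⁻ G disX a∉X)) (<-irrefl refl)

  witness-minus-isMax : CriticalWitness a b X → IsMaxDissociation G (X - a)
  witness-minus-isMax {a} {X = X} (disX , beats) =
    dissociation-minus G disX , λ S disS → m<1+n⇒m≤n (<-≤-trans (beats S disS) (∣p∣≤1+∣p-x∣ X a))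

  inA-∈-witness : CriticalWitness a b X → InA G x → x ∈ X × x ≢ a × x ≢ b
  inA-∈-witness {a} {b} {X} w x∈𝒜 =
    let x∈X-a = x∈𝒜 (X - a) (witness-minus-isMax w)
        x∈X-b = x∈𝒜 (X - b) (witness-minus-isMax (witness-comm w))
    in p-x⊆p X a x∈X-a , x∈p-y⇒x≢y X x∈X-a , x∈p-y⇒x≢y X x∈X-b

-- Sides of an edge in a tree

module Tree (G : Graph n) (tree : IsTree G) where

  adj-sym : Adj G u v → Adj G v u
  adj-sym = proj₁ (proj₂ tree) _ _

  adj⇒≢ : Adj G u v → u ≢ v
  adj⇒≢ {u} uu refl = proj₁ (proj₂ (proj₂ tree)) u uu

  connected : Connected G
  connected = proj₁ (proj₂ (proj₂ (proj₂ tree)))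

  acyclic : Acyclic G
  acyclic = proj₂ (proj₂ (proj₂ (proj₂ tree)))

  vertices : Walk G u v → List (Fin n)
  vertices (here {u})     = u ∷ []
  vertices (step {u} _ w) = u ∷ vertices w

  head∈vertices : (w : Walk G u v) → u ∈ₗ vertices w
  head∈vertices here       = here refl
  head∈vertices (step _ _) = here refl

  _◅◅_ : Walk G u v → Walk G v w → Walk G u w
  here      ◅◅ w′ = w′
  step uv w ◅◅ w′ = step uv (w ◅◅ w′)

  reverse : Walk G u v → Walk G v u
  reverse here        = here
  reverse (step uv w) = reverse w ◅◅ step (adj-sym uv) here

  ∈-◅◅ : (w : Walk G u v) (w′ : Walk G v x) → z ∈ₗ vertices (w ◅◅ w′) → z ∈ₗ vertices w ⊎ z ∈ₗ vertices w′
  ∈-◅◅ here       w′ z∈          = inj₂ z∈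
  ∈-◅◅ (step _ w) w′ (here refl) = inj₁ (here refl)
  ∈-◅◅ (step _ w) w′ (there z∈)  = [ inj₁ ∘ there , inj₂ ] (∈-◅◅ w w′ z∈)

  ∈-reverse : (w : Walk G u v) → z ∈ₗ vertices (reverse w) → z ∈ₗ vertices w
  ∈-reverse here z∈ = z∈
  ∈-reverse (step uv w) z∈ with ∈-◅◅ (reverse w) (step (adj-sym uv) here) z∈
  ... | inj₁ z∈w⁻¹               = there (∈-reverse w z∈w⁻¹)
  ... | inj₂ (here refl)         = there (head∈vertices w)
  ... | inj₂ (there (here refl)) = here refl

  suffixFrom : (w : Walk G u v) → Unique (vertices w) → z ∈ₗ vertices w →
               Σ (Walk G z v) λ w′ → Unique (vertices w′) × vertices w′ ⊆ₗ vertices w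
  suffixFrom here        uniq (here refl) = here , uniq , λ z∈ → z∈
  suffixFrom (step uv w) uniq (here refl) = step uv w , uniq , λ z∈ → z∈
  suffixFrom (step _ w) (_ ∷ uniq) (there z∈) =
    let w′ , uniq′ , w′⊆w = suffixFrom w uniq z∈ in w′ , uniq′ , there ∘ w′⊆w

  shortcut : (w : Walk G u v) → Σ (Walk G u v) λ w′ → Unique (vertices w′) × vertices w′ ⊆ₗ vertices w
  shortcut here = here , [] ∷ [] , λ z∈ → z∈
  shortcut (step {u} uv w) with shortcut w
  ... | w′ , uniq′ , w′⊆w with Any.any? (u ≟_) (vertices w′)
  ...   | yes u∈w′ = let w″ , uniq″ , w″⊆w′ = suffixFrom w′ uniq′ u∈w′ in w″ , uniq″ , there ∘ w′⊆w ∘ w″⊆w′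
  ...   | no  u∉w′ = step uv w′ , ¬Any⇒All¬ _ u∉w′ ∷ uniq′
                   , λ { (here refl) → here refl ; (there z∈) → there (w′⊆w z∈) }

  linked-closing : (w : Walk G u v) → Adj G v p → Linked (Adj G) (vertices w ∷ʳ p)
  linked-closing here                  vp = vp ∷ [-]
  linked-closing (step uv here)        vp = uv ∷ linked-closing here vp
  linked-closing (step uv (step vw w)) vp = uv ∷ linked-closing (step vw w) vp

  two≤length : (w : Walk G u v) → u ≢ v → 2 ≤ length (vertices w)
  two≤length here                u≢u = contradiction refl u≢u
  two≤length (step _ here)       _   = s≤s (s≤s z≤n)
  two≤length (step _ (step _ _)) _   = s≤s (s≤s z≤n)

  joined-neighbours-equal : Adj G p q → Adj G q′ p → (w : Walk G q q′) → p ∉ₗ vertices w → q ≡ q′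
  joined-neighbours-equal {p} {q} {q′} pq q′p w p∉w with q ≟ q′ | shortcut w
  ... | yes q≡q′ | _ = q≡q′
  ... | no  q≢q′ | w′ , uniq′ , w′⊆w =
    contradiction (two≤length w′ q≢q′ , ¬Any⇒All¬ _ (p∉w ∘ w′⊆w) ∷ uniq′ , cycle w′)
                  (acyclic p (vertices w′))
    where
    cycle : (w′ : Walk G q q′) → Linked (Adj G) ((p ∷ vertices w′) ∷ʳ p)
    cycle here         = pq ∷ linked-closing here q′p
    cycle (step qr w″) = pq ∷ linked-closing (step qr w″) q′p

  -- The vertex from which w first enters p; on the empty walk (x = p) it is the junk value x.
  gateOf : Walk G x p → Fin n
  gateOf {x} here = x
  gateOf {x} {p} (step {w = y} _ rest) with y ≟ p
  ... | yes _ = x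
  ... | no  _ = gateOf rest

  gateOf-spec : x ≢ p → (w : Walk G x p) →
                Σ (Walk G x (gateOf w)) λ w′ → p ∉ₗ vertices w′ × Adj G (gateOf w) p
  gateOf-spec x≢p here = contradiction refl x≢p
  gateOf-spec {x} {p} x≢p (step {w = y} xy rest) with y ≟ p
  ... | yes refl = here , (λ { (here p≡x) → x≢p (sym p≡x) }) , xy
  ... | no  y≢p  = let w′ , p∉w′ , gp = gateOf-spec y≢p rest in
    step xy w′ , (λ { (here p≡x) → x≢p (sym p≡x) ; (there p∈w′) → p∉w′ p∈w′ }) , gp

  gate : Fin n → Fin n → Fin n
  gate p x = gateOf (connected x p)

  gate-unique : (w : Walk G x q) → p ∉ₗ vertices w → Adj G q p → q ≡ gate p x
  gate-unique {x} {q} {p} w p∉w qp =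
    let w₀ , p∉w₀ , gp = gateOf-spec x≢p (connected x p) in
    joined-neighbours-equal (adj-sym qp) gp (reverse w ◅◅ w₀)
      λ p∈ → [ p∉w ∘ ∈-reverse w , p∉w₀ ] (∈-◅◅ (reverse w) w₀ p∈)
    where
    x≢p : x ≢ p
    x≢p x≡p = p∉w (subst (_∈ₗ vertices w) x≡p (head∈vertices w))

  gate-neighbour : Adj G x p → gate p x ≡ x
  gate-neighbour xp = sym (gate-unique here (λ { (here p≡x) → adj⇒≢ xp (sym p≡x) }) xp)

  gate-step : Adj G x y → x ≢ p → y ≢ p → gate p x ≡ gate p y
  gate-step {x} {y} {p} xy x≢p y≢p =
    let w , p∉w , gp = gateOf-spec y≢p (connected y p) in
    sym (gate-unique (step xy w) (λ { (here p≡x) → x≢p (sym p≡x) ; (there p∈w) → p∉w p∈w }) gp)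

  -- For an edge pr this is the vertex set of the component of G − pr containing r.
  side : Fin n → Fin n → Subset n
  side p r = subsetOf λ x → ¬? (x ≟ p) ×-dec gate p x ≟ r

  ∈side⁺ : x ≢ p → gate p x ≡ r → x ∈ side p r
  ∈side⁺ {x} {p} {r} x≢p gate≡r = ∈subsetOf⁺ (λ x → ¬? (x ≟ p) ×-dec gate p x ≟ r) (x≢p , gate≡r)

  ∈side⁻ : x ∈ side p r → x ≢ p × gate p x ≡ r
  ∈side⁻ {p = p} {r} = ∈subsetOf⁻ λ x → ¬? (x ≟ p) ×-dec gate p x ≟ r

  ∈side⇒≢ : x ∈ side p r → x ≢ p
  ∈side⇒≢ = proj₁ ∘ ∈side⁻

  p∉side : p ∉ side p r
  p∉side p∈ = ∈side⇒≢ p∈ refl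

  r∈side : Adj G p r → r ∈ side p r
  r∈side pr = ∈side⁺ (adj⇒≢ (adj-sym pr)) (gate-neighbour (adj-sym pr))

  side-step : Adj G x y → y ∈ side p r → x ≢ p → x ∈ side p r
  side-step xy y∈ x≢p = let y≢p , gate≡r = ∈side⁻ y∈ in
    ∈side⁺ x≢p (trans (gate-step xy x≢p y≢p) gate≡r)

  side-boundary : Adj G p r → Adj G s t → s ∈ side p r → t ∉ side p r → s ≡ r × t ≡ p
  side-boundary {p} {t = t} pr st s∈ t∉ with t ≟ p
  ... | yes refl = trans (sym (gate-neighbour st)) (proj₂ (∈side⁻ s∈)) , refl
  ... | no  t≢p  = contradiction (side-step (adj-sym st) s∈ t≢p) t∉

  side-neighbour : Adj G p r → Adj G t p → t ∈ side p r → t ≡ r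
  side-neighbour pr tp t∈ = proj₁ (side-boundary pr tp t∈ p∉side)

  side-cover : Adj G p r → ∀ x → x ∈ side p r ⊎ x ∈ side r p
  side-cover {p} {r} pr x = go (connected x p)
    where
    go : Walk G y p → y ∈ side p r ⊎ y ∈ side r p
    go here = inj₂ (r∈side (adj-sym pr))
    go (step {y} yy′ rest) with go rest | y ≟ p | y ≟ r
    ... | inj₁ _   | yes refl | _        = inj₂ (r∈side (adj-sym pr))
    ... | inj₁ y′∈ | no y≢p   | _        = inj₁ (side-step yy′ y′∈ y≢p)
    ... | inj₂ _   | _        | yes refl = inj₁ (r∈side pr)
    ... | inj₂ y′∈ | _        | no y≢r   = inj₂ (side-step yy′ y′∈ y≢r)

  side-nested : Adj G v u → Adj G v w → u ≢ w → side v u ⊆ side w v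
  side-nested vu vw u≢w {x} x∈ with side-cover (adj-sym vw) x
  ... | inj₁ x∈side-wv = x∈side-wv
  ... | inj₂ x∈side-vw = contradiction (trans (sym (proj₂ (∈side⁻ x∈))) (proj₂ (∈side⁻ x∈side-vw))) u≢w

-- Exchanging dissociation sets across an edge of a tree

module CriticalEdges (G : Graph n) (tree : IsTree G) where

  open Tree G tree

  -- Only the edge pr joins side p r to the rest of G, so gluing is harmless once that edge cannot
  -- be used inside the glued set.
  glue-dissociation : Adj G p r → F ⊆ₑ G →
    IsDissociation F₁ f → IsDissociation F₂ g →
    (∀ {x y} → x ∈ side p r → y ∈ side p r → Adj F x y → Adj F₁ x y) →
    (∀ {x y} → x ∉ side p r → y ∉ side p r → Adj F x y → Adj F₂ x y) →
    (r ∈ glue (side p r) f g → p ∈ glue (side p r) f g → ¬ Adj F r p × ¬ Adj F p r) →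
    IsDissociation F (glue (side p r) f g)
  glue-dissociation {p} {r} {F} {f = f} {g = g} pr F⊆G disf disg in-side out-side pr-unused = dissociation
    where
    glued : Subset n
    glued = glue (side p r) f g

    stays-inside : x ∈ glued → y ∈ glued → Adj F x y → x ∈ side p r → y ∈ side p r
    stays-inside {y = y} x∈ y∈ xy x∈B with y ∈? side p r
    ... | yes y∈B = y∈B
    ... | no  y∉B with side-boundary pr (F⊆G xy) x∈B y∉B
    ...   | refl , refl = contradiction xy (proj₁ (pr-unused x∈ y∈))

    stays-outside : x ∈ glued → y ∈ glued → Adj F x y → x ∉ side p r → y ∉ side p r
    stays-outside x∈ y∈ xy x∉B y∈B with side-boundary pr (adj-sym (F⊆G xy)) y∈B x∉B
    ... | refl , refl = proj₂ (pr-unused y∈ x∈) xy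

    dissociation : IsDissociation F glued
    dissociation v u w v∈ u∈ w∈ vu vw with v ∈? side p r
    ... | yes v∈B = let u∈B = stays-inside v∈ u∈ vu v∈B ; w∈B = stays-inside v∈ w∈ vw v∈B in
      disf v u w (glue-inside v∈ v∈B) (glue-inside u∈ u∈B) (glue-inside w∈ w∈B)
           (in-side v∈B u∈B vu) (in-side v∈B w∈B vw)
    ... | no  v∉B = let u∉B = stays-outside v∈ u∈ vu v∉B ; w∉B = stays-outside v∈ w∈ vw v∉B in
      disg v u w (glue-outside v∈ v∉B) (glue-outside u∈ u∉B) (glue-outside w∈ w∉B)
           (out-side v∉B u∉B vu) (out-side v∉B w∉B vw)

  -- Otherwise Y glued into X on the side of b is a dissociation set of G − ab missing b, hence
  -- of G, and at least as large as X.
  exchange : Adj G a b → CriticalWitness G a b X → IsDissociation (deleteEdge G a b) Y →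
             ∣ X ∩ side a b ∣ ≤ ∣ Y ∩ side a b ∣ → b ∈ Y
  exchange {a} {b} {X} {Y} ab (disX , beats) disY dominated with b ∈? Y
  ... | yes b∈Y = b∈Y
  ... | no  b∉Y = contradiction (∣∣-≤-glue (side a b) Y X dominated) (<⇒≱ (beats Z disZ))
    where
    Z : Subset n
    Z = glue (side a b) Y X

    b∉Z : b ∉ Z
    b∉Z b∈Z = b∉Y (glue-inside b∈Z (r∈side ab))

    disZ : IsDissociation G Z
    disZ = dissociation-deleteEdge⁻ G (dissociation-deleteEdge-comm G
      (glue-dissociation ab (deleteEdge⊆ₑ G) disY disX (λ _ _ xy → xy) (λ _ _ xy → xy)
        λ _ _ → deleteEdge-removes′ G , deleteEdge-removes G)) b∉Z

  side-gain⇒critical : Adj G p r → IsMaxDissociation G S → IsDissociation (deleteEdge G p q) Y →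
    ∣ S ∩ side p r ∣ < ∣ Y ∩ side p r ∣ → Critical G p r
  side-gain⇒critical {p} {r} {S} {Y = Y} pr (disS , maxS) disY gain =
    witness⇒critical G pr (disZ , λ S′ disS′ → ≤-<-trans (maxS S′ disS′) (∣∣-<-glue (side p r) Y S gain))
    where
    disZ : IsDissociation (deleteEdge G p r) (glue (side p r) Y S)
    disZ = glue-dissociation pr (deleteEdge⊆ₑ G) disY disS
      (λ x∈ y∈ xy → deleteEdge-keeps-avoiding G (deleteEdge⊆ₑ G xy) (∈side⇒≢ x∈) (∈side⇒≢ y∈))
      (λ _ _ → deleteEdge⊆ₑ G)
      (λ _ _ → deleteEdge-removes′ G , deleteEdge-removes G)

  module _ (vu : Adj G v u) (vw : Adj G v w) (u≢w : u ≢ w)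
           (w₁ : CriticalWitness G v u X₁) (w₂ : CriticalWitness G w v X₂)
           (disS : IsDissociation (deleteEdge G w v) S) where

    private
      U V : Subset n
      U = side v u
      V = side w v

      v∉U : v ∉ U
      v∉U = p∉side

    -- Otherwise X₁ glued into S − v on the side of u is a dissociation set of G − wv missing v
    -- that still dominates X₂ on the side of v, against exchange.
    propagate : ∣ X₂ ∩ V ∣ ≤ ∣ S ∩ V ∣ → ∣ X₁ ∩ U ∣ ≤ ∣ S ∩ U ∣
    propagate dominated with ∣ X₁ ∩ U ∣ ≤? ∣ S ∩ U ∣
    ... | yes X₁-dominated = X₁-dominated
    ... | no  ¬X₁-dominated =
      contradiction (exchange (adj-sym vw) w₂ disS″ (≤-trans dominated ∣S∩V∣≤∣S″∩V∣)) v∉S″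
      where
      S″ : Subset n
      S″ = glue U X₁ (S - v)

      v∉S″ : v ∉ S″
      v∉S″ v∈S″ = x∈p-y⇒x≢y S (glue-outside v∈S″ v∉U) refl

      disS″ : IsDissociation (deleteEdge G w v) S″
      disS″ = glue-dissociation vu (deleteEdge⊆ₑ G) (proj₁ w₁) (dissociation-⊆ (p-x⊆p S v) disS)
        (λ x∈U y∈U xy → deleteEdge-keeps-avoiding G (deleteEdge⊆ₑ G xy) (∈side⇒≢ x∈U) (∈side⇒≢ y∈U))
        (λ _ _ xy → xy)
        (λ _ v∈S″ → contradiction v∈S″ v∉S″)

      ∣S-v∩U∣<∣X₁∩U∣ : ∣ (S - v) ∩ U ∣ < ∣ X₁ ∩ U ∣
      ∣S-v∩U∣<∣X₁∩U∣ = ≤-<-trans (p⊆q⇒∣p∣≤∣q∣ (∩-monoˡ-⊆ U (p-x⊆p S v))) (≰⇒> ¬X₁-dominated)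

      ∣S∩V∣≤∣S″∩V∣ : ∣ S ∩ V ∣ ≤ ∣ S″ ∩ V ∣
      ∣S∩V∣≤∣S″∩V∣ = begin
        ∣ S ∩ V ∣             ≤⟨ ∣p∣≤1+∣p-x∣ (S ∩ V) v ⟩
        suc ∣ (S ∩ V) - v ∣   ≤⟨ s≤s (p⊆q⇒∣p∣≤∣q∣ (p∩q-x⊆p-x∩q S V v)) ⟩
        suc ∣ (S - v) ∩ V ∣   ≤⟨ ∣∣-<-glue-within U X₁ (S - v) (side-nested vu vw u≢w) ∣S-v∩U∣<∣X₁∩U∣ ⟩
        ∣ S″ ∩ V ∣            ∎
        where open ≤-Reasoning

    propagate-∈ : ∣ X₂ ∩ V ∣ ≤ ∣ S ∩ V ∣ → u ∈ S × v ∈ S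
    propagate-∈ dominated = p-x⊆p S v u∈S-v , exchange (adj-sym vw) w₂ disS dominated
      where
      disS-v : IsDissociation (deleteEdge G v u) (S - v)
      disS-v = dissociation-⊆ₑ (deleteEdge⊆ₑ G) (dissociation-minus G (dissociation-deleteEdge-comm G disS))

      u∈S-v : u ∈ S - v
      u∈S-v = exchange vu w₁ disS-v
        (≤-trans (propagate dominated) (p⊆q⇒∣p∣≤∣q∣ (x∉q⇒p∩q⊆p-x∩q S U v∉U)))

  no-witnessed-4-path : Unique (a ∷ b ∷ c ∷ d ∷ []) → Adj G a b → Adj G b c → Adj G c d →
    CriticalWitness G a b X₁ → CriticalWitness G b c X₂ → CriticalWitness G c d X₃ → ⊥
  no-witnessed-4-path {a} {b} {c} {d} {X₁} {X₂}
    ((_ ∷ a≢c ∷ _ ∷ []) ∷ (b≢c ∷ b≢d ∷ []) ∷ _) ab bc cd w₁ w₂ w₃ =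
    let c∈X₁ , b∈X₁ = propagate-∈ bc (adj-sym ab) (a≢c ∘ sym) w₂ w₁ (proj₁ w₁) ≤-refl
        d∈X₁-b , _  = propagate-∈ cd (adj-sym bc) (b≢d ∘ sym) w₃ w₂ disX₁-b X₁-b-dominates
    in b≢d (proj₁ w₁ c b d c∈X₁ b∈X₁ (p-x⊆p X₁ b d∈X₁-b) (from-c (adj-sym bc)) (from-c cd))
    where
    from-c : Adj G c x → Adj (deleteEdge G a b) c x
    from-c cx = deleteEdge-keeps-from G cx (a≢c ∘ sym) (b≢c ∘ sym)

    disX₁-b : IsDissociation (deleteEdge G b c) (X₁ - b)
    disX₁-b = dissociation-⊆ₑ (deleteEdge⊆ₑ G)
                (dissociation-minus G (dissociation-deleteEdge-comm G (proj₁ w₁)))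

    X₁-b-dominates : ∣ X₂ ∩ side b c ∣ ≤ ∣ (X₁ - b) ∩ side b c ∣
    X₁-b-dominates = ≤-trans (propagate bc (adj-sym ab) (a≢c ∘ sym) w₂ w₁ (proj₁ w₁) ≤-refl)
                             (p⊆q⇒∣p∣≤∣q∣ (x∉q⇒p∩q⊆p-x∩q X₁ (side b c) p∉side))

  no-witnessed-claw : Unique (c ∷ x ∷ y ∷ z ∷ []) → Adj G c x → Adj G c y → Adj G c z →
    CriticalWitness G c x X → CriticalWitness G c y X₁ → CriticalWitness G c z X₂ → ⊥
  no-witnessed-claw {c} {x} {y} {z} {X}
    ((c≢x ∷ _) ∷ (x≢y ∷ x≢z ∷ []) ∷ (y≢z ∷ []) ∷ _) cx cy cz w wy wz =
    let y∈X , c∈X = propagate-∈ cy cx (x≢y ∘ sym) wy wₓ (proj₁ wₓ) ≤-refl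
        z∈X , _   = propagate-∈ cz cx (x≢z ∘ sym) wz wₓ (proj₁ wₓ) ≤-refl
    in y≢z (proj₁ wₓ c y z c∈X y∈X z∈X
             (deleteEdge-keeps-avoiding G cy c≢x (x≢y ∘ sym))
             (deleteEdge-keeps-avoiding G cz c≢x (x≢z ∘ sym)))
    where
    wₓ : CriticalWitness G x c X
    wₓ = witness-comm G w

  witnessed-3-path-avoids-𝒜 : a ≢ b → a ≢ c → b ≢ c → Adj G a b → Adj G b c →
    CriticalWitness G a b X₁ → CriticalWitness G b c X₂ → InA G y →
    ¬ Adj G a y × ¬ Adj G b y × ¬ Adj G c y
  witnessed-3-path-avoids-𝒜 {a} {b} {c} {X₁} {X₂} {y} a≢b a≢c b≢c ab bc w₁ w₂ y∈𝒜 =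
    let a∈X₂ , b∈X₂     = propagate-∈ (adj-sym ab) bc a≢c (witness-comm G w₁) (witness-comm G w₂)
                            (dissociation-deleteEdge-comm G (proj₁ w₂)) ≤-refl
        c∈X₁ , b∈X₁     = propagate-∈ bc (adj-sym ab) (a≢c ∘ sym) w₂ w₁ (proj₁ w₁) ≤-refl
        y∈X₁ , y≢a , _  = inA-∈-witness G w₁ y∈𝒜
        y∈X₂ , y≢b , y≢c = inA-∈-witness G w₂ y∈𝒜
    in (λ ay → y≢b (sym (proj₁ w₂ a b y a∈X₂ b∈X₂ y∈X₂ (avoiding-c ab a≢c b≢c) (avoiding-c ay a≢c y≢c))))
     , (λ by → y≢a (sym (proj₁ w₂ b a y b∈X₂ a∈X₂ y∈X₂
                          (avoiding-c (adj-sym ab) b≢c a≢c) (avoiding-c by b≢c y≢c))))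
     , (λ cy → y≢b (sym (proj₁ w₁ c b y c∈X₁ b∈X₁ y∈X₁
                          (avoiding-a (adj-sym bc) (a≢c ∘ sym) (a≢b ∘ sym))
                          (avoiding-a cy (a≢c ∘ sym) y≢a))))
    where
    avoiding-a : Adj G u v → u ≢ a → v ≢ a → Adj (deleteEdge G a b) u v
    avoiding-a = deleteEdge-keeps-avoiding G

    avoiding-c : Adj G u v → u ≢ c → v ≢ c → Adj (deleteEdge G b c) u v
    avoiding-c = deleteEdge-keeps-avoiding′ G

  module InsulatedEnd (uv : Adj G u v) (wX : CriticalWitness G u v X)
         (only-uv-at-u : ∀ w → Critical G u w → w ≡ v) (only-uv-at-v : ∀ w → Critical G v w → w ≡ u) where

    private
      vu : Adj G v u
      vu = adj-sym uv

      U : Subset n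
      U = side v u

      disX : IsDissociation (deleteEdge G u v) X
      disX = proj₁ wX

      u∈X : u ∈ X
      u∈X = witness-∋ G wX

      v∈X : v ∈ X
      v∈X = witness-∋ G (witness-comm G wX)

      u≢v : u ≢ v
      u≢v = adj⇒≢ uv

      avoiding-u : Adj G x y → x ≢ u → y ≢ u → Adj (deleteEdge G u v) x y
      avoiding-u = deleteEdge-keeps-avoiding G

      avoiding-v : Adj G x y → x ≢ v → y ≢ v → Adj (deleteEdge G u v) x y
      avoiding-v = deleteEdge-keeps-avoiding′ G

      glued-dissociation : IsDissociation (deleteEdge G u v) Y → (∀ t → t ∈ Y → Adj G u t → t ≡ v) →
        F ⊆ₑ G → (∀ t → t ∈ X → Adj F v t → t ≡ u) → IsDissociation F (glue U Y X)
      glued-dissociation {Y} {F} disY u-only-v F⊆G v-only-u =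
        dissociation-restoreEdge F glued-in-F-uv u-only-v′ v-only-u′
        where
        F-uv⊆G-uv : deleteEdge F u v ⊆ₑ deleteEdge G u v
        F-uv⊆G-uv = deleteEdge-mono {F = F} {G} {u} {v} F⊆G

        glued-in-F-uv : IsDissociation (deleteEdge F u v) (glue U Y X)
        glued-in-F-uv = glue-dissociation vu (λ xy → deleteEdge⊆ₑ G (F-uv⊆G-uv xy)) disY disX
          (λ _ _ → F-uv⊆G-uv) (λ _ _ → F-uv⊆G-uv) (λ _ _ → deleteEdge-removes F , deleteEdge-removes′ F)

        u-only-v′ : ∀ t → t ∈ glue U Y X → Adj F u t → t ≡ v
        u-only-v′ t t∈ ut with t ∈? U
        ... | yes t∈U = u-only-v t (glue-inside t∈ t∈U) (F⊆G ut)
        ... | no  t∉U = proj₂ (side-boundary vu (F⊆G ut) (r∈side vu) t∉U)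

        v-only-u′ : ∀ t → t ∈ glue U Y X → Adj F v t → t ≡ u
        v-only-u′ t t∈ vt with t ∈? U
        ... | yes t∈U = proj₁ (side-boundary vu (adj-sym (F⊆G vt)) t∈U p∉side)
        ... | no  t∉U = v-only-u t (glue-outside t∈ t∉U) vt

    -- Otherwise Y glued into X on the side of u has at least |X| > α₃(G) vertices and is a
    -- dissociation set of G, or of G − vw when v has an X-neighbour w ≠ u, making vw critical.
    no-gain : IsDissociation (deleteEdge G u v) Y → (∀ t → t ∈ Y → Adj G u t → t ≡ v) →
              ∣ Y ∩ U ∣ < ∣ X ∩ U ∣
    no-gain {Y} disY u-only-v with ∣ X ∩ U ∣ ≤? ∣ Y ∩ U ∣
    ... | no  ¬gain = ≰⇒> ¬gain
    ... | yes gain with other-neighbour? G X v u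
    ...   | inj₂ v-only-u = contradiction (∣∣-≤-glue U Y X gain)
                              (<⇒≱ (proj₂ wX _ (glued-dissociation disY u-only-v (λ vt → vt) v-only-u)))
    ...   | inj₁ (w , w∈X , vw , w≢u) = contradiction (only-uv-at-v w vw-critical) w≢u
      where
      v-only-u : ∀ t → t ∈ X → Adj (deleteEdge G v w) v t → t ≡ u
      v-only-u t t∈X vt with t ≟ u
      ... | yes t≡u = t≡u
      ... | no  t≢u with disX v t w v∈X t∈X w∈X
                           (avoiding-u (deleteEdge⊆ₑ G vt) (u≢v ∘ sym) t≢u) (avoiding-u vw (u≢v ∘ sym) w≢u)
      ...   | refl = contradiction vt (deleteEdge-removes G)

      vw-critical : Critical G v w
      vw-critical = witness⇒critical G vw
        ( glued-dissociation disY u-only-v (deleteEdge⊆ₑ G) v-only-u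
        , λ S disS → <-≤-trans (proj₂ wX S disS) (∣∣-≤-glue U Y X gain))

    other-X-neighbour : ∃ λ y → y ∈ X × Adj G u y × y ≢ v
    other-X-neighbour with other-neighbour? G X u v
    ... | inj₁ found    = found
    ... | inj₂ u-only-v = contradiction (no-gain disX u-only-v) (<-irrefl refl)

    module _ (y∈X : y ∈ X) (uy : Adj G u y) (y≢v : y ≢ v) where

      -- A maximum M missing y would do at least as well as X on the side of y (else uy would be
      -- critical), and M glued into X there would contradict no-gain.
      y∈𝒜 : InA G y
      y∈𝒜 M (disM , maxM) with y ∈? M
      ... | yes y∈M = y∈M
      ... | no  y∉M =
        contradiction (no-gain disZ u-only-v) (≤⇒≯ (∣∣-≤-glue-within Wy M X Wy⊆U X-loses-on-Wy))
        where
        Wy : Subset n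
        Wy = side u y

        Wy⊆U : Wy ⊆ U
        Wy⊆U = side-nested uy uv y≢v

        X-loses-on-Wy : ∣ X ∩ Wy ∣ ≤ ∣ M ∩ Wy ∣
        X-loses-on-Wy with ∣ X ∩ Wy ∣ ≤? ∣ M ∩ Wy ∣
        ... | yes loses = loses
        ... | no  gains =
          contradiction (only-uv-at-u y (side-gain⇒critical uy (disM , maxM) disX (≰⇒> gains))) y≢v

        Z : Subset n
        Z = glue Wy M X

        disZ : IsDissociation (deleteEdge G u v) Z
        disZ = glue-dissociation uy (deleteEdge⊆ₑ G) disM disX (λ _ _ → deleteEdge⊆ₑ G) (λ _ _ xy → xy)
          (λ y∈Z _ → contradiction (glue-inside y∈Z (r∈side uy)) y∉M)

        u-only-v : ∀ t → t ∈ Z → Adj G u t → t ≡ v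
        u-only-v t t∈Z ut with t ≟ v | t ∈? Wy
        ... | yes t≡v | _ = t≡v
        ... | no  _   | yes t∈Wy with side-neighbour uy (adj-sym ut) t∈Wy
        ...   | refl = contradiction (glue-inside t∈Z t∈Wy) y∉M
        u-only-v t t∈Z ut | no t≢v | no t∉Wy
          with disX u y t u∈X y∈X (glue-outside t∈Z t∉Wy) (avoiding-v uy u≢v y≢v) (avoiding-v ut u≢v t≢v)
        ...   | refl = contradiction (r∈side uy) t∉Wy

      unique : ∀ z → Adj G u z → InA G z → z ≡ y
      unique z uz z∈𝒜 = let z∈X , _ , z≢v = inA-∈-witness G wX z∈𝒜 in
        sym (disX u y z u∈X y∈X z∈X (avoiding-v uy u≢v y≢v) (avoiding-v uz u≢v z≢v))

      isolated : ∀ z → InA G z → ¬ Adj G y z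
      isolated z z∈𝒜 yz = let z∈X , z≢u , z≢v = inA-∈-witness G wX z∈𝒜 in
        z≢u (sym (disX y u z y∈X u∈X z∈X (avoiding-v (adj-sym uy) y≢v u≢v) (avoiding-v yz y≢v z≢v)))

    unique-isolated-𝒜-neighbour : UniqueIsolatedANeighbour G u
    unique-isolated-𝒜-neighbour = let _ , y∈X , uy , y≢v = other-X-neighbour in
      _ , (uy , y∈𝒜 y∈X uy y≢v) , unique y∈X uy y≢v , isolated y∈X uy y≢v

  no-critical-4-path : ∀ a b c d → ¬ Critical4Path G a b c d
  no-critical-4-path _ _ _ _ (distinct , ab , bc , cd) =
    no-witnessed-4-path distinct (proj₁ ab) (proj₁ bc) (proj₁ cd)
      (proj₂ (critical⇒witness G ab)) (proj₂ (critical⇒witness G bc)) (proj₂ (critical⇒witness G cd))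

  no-critical-claw : ∀ c x y z → ¬ CriticalClaw G c x y z
  no-critical-claw _ _ _ _ (distinct , cx , cy , cz) =
    no-witnessed-claw distinct (proj₁ cx) (proj₁ cy) (proj₁ cz)
      (proj₂ (critical⇒witness G cx)) (proj₂ (critical⇒witness G cy)) (proj₂ (critical⇒witness G cz))

  insulated-ends : ∀ u v → Insulated G u v → UniqueIsolatedANeighbour G u × UniqueIsolatedANeighbour G v
  insulated-ends _ _ (uv , only-uv-at-u , _ , only-uv-at-v , _) =
    let wX = proj₂ (critical⇒witness G uv) in
      InsulatedEnd.unique-isolated-𝒜-neighbour (proj₁ uv) wX only-uv-at-u only-uv-at-v
    , InsulatedEnd.unique-isolated-𝒜-neighbour (adj-sym (proj₁ uv)) (witness-comm G wX)
                                               only-uv-at-v only-uv-at-u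

  critical-3-path-avoids-𝒜 : ∀ a b c → Critical3Path G a b c →
    ∀ x → (x ≡ a ⊎ x ≡ b ⊎ x ≡ c) → ∀ y → InA G y → ¬ Adj G x y
  critical-3-path-avoids-𝒜 _ _ _ (a≢b , a≢c , b≢c , ab , bc) x x∈abc y y∈𝒜
    with witnessed-3-path-avoids-𝒜 a≢b a≢c b≢c (proj₁ ab) (proj₁ bc)
           (proj₂ (critical⇒witness G ab)) (proj₂ (critical⇒witness G bc)) y∈𝒜
  ... | ¬ay , ¬by , ¬cy with x∈abc
  ...   | inj₁ refl        = ¬ay
  ...   | inj₂ (inj₁ refl) = ¬by
  ...   | inj₂ (inj₂ refl) = ¬cy

theorem3p6 : ∀ {n : ℕ} (T : Graph n) → IsTree T →
    ((∀ a b c d → ¬ Critical4Path T a b c d) × (∀ c x y z → ¬ CriticalClaw T c x y z))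
    × (∀ u v → Insulated T u v → UniqueIsolatedANeighbour T u × UniqueIsolatedANeighbour T v)
    × (∀ a b c → Critical3Path T a b c → ∀ x → (x ≡ a ⊎ x ≡ b ⊎ x ≡ c) → ∀ y → InA T y → ¬ Adj T x y)
theorem3p6 T tree =
    (no-critical-4-path , no-critical-claw)
  , insulated-ends
  , critical-3-path-avoids-𝒜
  where open CriticalEdges T tree
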